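{- There exists a family of square matrices over a constant-size alphabet $\Sigma$, all with $\delta_{2D}=O(1)$, whose worst-case entropy is $\Omega(\sqrt{n}\log n)$: that is, for infinitely many $n$ there is a set $\mathcal{F}_n\subseteq\Sigma^{n\times n}$ with $\delta_{2D}(M)=O(1)$ for every $M\in\mathcal{F}_n$ and $\lceil\log_2|\mathcal{F}_n|\rceil=\Omega(\sqrt{n}\log n)$.
   Context: For $M\in\Sigma^{n\times n}$ and $k\in[1,n]$ let $d_{k\times k}(M)$ be the number of distinct $k\times k$ submatrices (contiguous square blocks of $k$ consecutive rows and $k$ consecutive columns) of $M$, and $\delta_{2D}(M)=\max\{d_{k\times k}(M)/k^2 : k\in[1,n]\}$. The worst-case entropy of a finite set $S$ is $\lceil\log_2|S|\rceil$, the minimum number of bits needed to encode all elements of $S$. -}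

module Defs where

open import Data.Nat using (ℕ; _+_; _*_; _∸_; _≤_)
open import Data.Fin using (Fin)
open import Data.Fin.Properties using () renaming (_≟_ to _≟ᶠ_)
open import Data.Vec using (Vec; toList)
open import Data.List using (List; map; take; drop; upTo; length; deduplicate; cartesianProductWith)
open import Data.List.Properties using (≡-dec)

-- An n×n matrix over the alphabet Fin σ (σ = alphabet size), stored row-wise.
Matrix : ℕ → ℕ → Set
Matrix σ n = Vec (Vec (Fin σ) n) n

window : {A : Set} → ℕ → ℕ → List A → List A
window k i xs = take k (drop i xs)

-- all k×k contiguous blocks of M (top-left corner (i,j), 0 ≤ i,j ≤ n-k),
-- each block represented as the list of its k rows (each a list of k entries).
-- Meaningful for 1 ≤ k ≤ n.
blocks : ∀ {σ n} → ℕ → Matrix σ n → List (List (List (Fin σ)))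
blocks {σ} {n} k M =
  cartesianProductWith (λ i j → map (window k j) (window k i rows))
                       (upTo (n ∸ k + 1)) (upTo (n ∸ k + 1))
  where
  rows : List (List (Fin σ))
  rows = map toList (toList M)

d : ∀ {σ n} → ℕ → Matrix σ n → ℕ
d k M = length (deduplicate (≡-dec (≡-dec _≟ᶠ_)) (blocks k M))

-- δ_2D(M) ≤ c, i.e. max_{k∈[1,n]} d_{k×k}(M)/k² ≤ c (unfolded: d_{k×k}(M) ≤ c·k² for all k∈[1,n])
δ2D≤ : ∀ {σ n} → Matrix σ n → ℕ → Set
δ2D≤ {n = n} M c = ∀ k → 1 ≤ k → k ≤ n → d k M ≤ c * (k * k)

{-# OPTIONS --safe #-}
module Submission where

-- Encode a word x ∈ [m]^m as a 0/1 row of length n = 2m², writing each letter i as the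
-- one-hot block e_i ∈ {0,1}^m followed by m zeros, and let M_x be that row on top of an
-- all-zero n×n matrix. Every k×k block of M_x is determined by a length-k window of the
-- row, so M_x has at most n + 1 distinct k×k blocks, which is ≤ 2k² once k > m. For
-- k ≤ m + 1 a window contains at most one 1, leaving only k + 1 possibilities. Hence
-- δ_2D(M_x) ≤ 2 for all m^m distinct matrices M_x; for m = 2^e, log₂(m^m) = e·2^e
-- while √n · log₂ n ≈ 2^e · 2e.

open import Defs
open import Data.Nat using (ℕ; zero; suc; pred; _+_; _*_; _∸_; _^_; _≤_; _<_; _≥_; z≤n; s≤s; _⊓_)
open import Data.Nat.Properties
open import Data.Nat.Logarithm using (⌊log₂_⌋; ⌈log₂_⌉; ⌊log₂[2^n]⌋≡n; ⌈log₂2^n⌉≡n)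
open import Data.Nat.Solver using (module +-*-Solver)
open import Data.Fin using (Fin; zero; suc)
open import Data.Fin.Properties using () renaming (_≟_ to _≟ᶠ_)
open import Data.Vec as V using (Vec; toList; _∷_; [])
open import Data.Vec.Properties using (length-toList; toList-++; toList-replicate; ++-injective; ∷-injective; ∷-injectiveˡ; ∷-injectiveʳ)
open import Data.List as L using (List; map; take; drop; upTo; length; replicate; cartesianProductWith; allFin; _++_)
open import Data.List.Properties using (≡-dec; length-++; length-map; length-take; length-drop; length-upTo; length-tabulate; map-replicate)
open import Data.List.Membership.Propositional using (_∈_)
open import Data.List.Membership.Propositional.Properties
open import Data.List.Relation.Binary.Subset.Propositional using (_⊆_)
open import Data.List.Relation.Unary.All as All using (All)
import Data.List.Relation.Unary.All.Properties as All
open import Data.List.Relation.Unary.AllPairs using ([]; _∷_)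
open import Data.List.Relation.Unary.Any using (here; there)
open import Data.List.Relation.Unary.Unique.Propositional using (Unique)
open import Data.List.Relation.Unary.Unique.Propositional.Properties using (map⁺; cartesianProductWith⁺; allFin⁺)
import Data.List.Relation.Unary.Unique.DecPropositional.Properties as DecUnique
open import Data.Product using (Σ; _×_; ∃-syntax; _,_)
open import Data.Sum using (_⊎_; inj₁; inj₂)
open import Relation.Binary.PropositionalEquality
open import Relation.Nullary using (yes; no; contradiction)
open import Function using (_∘_)
open import Relation.Binary.Definitions using (DecidableEquality)

private
  variable
    A : Set
    σ n : ℕ

Unique-length-≤ : {xs ys : List A} → Unique xs → xs ⊆ ys → length xs ≤ length ys
Unique-length-≤ {xs = L.[]} _ _ = z≤n
Unique-length-≤ {xs = x L.∷ xs} (x∉xs ∷ u) xxs⊆ys with ∈-∃++ (xxs⊆ys (here refl))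
... | as , bs , refl = begin
  suc (length xs)               ≤⟨ s≤s (Unique-length-≤ u xs⊆as++bs) ⟩
  suc (length (as ++ bs))       ≡⟨ cong suc (length-++ as) ⟩
  suc (length as + length bs)   ≡⟨ +-suc (length as) (length bs) ⟨
  length as + suc (length bs)   ≡⟨ length-++ as ⟨
  length (as ++ x L.∷ bs)       ∎
  where
  open ≤-Reasoning
  xs⊆as++bs : xs ⊆ as ++ bs
  xs⊆as++bs p with ∈-++⁻ as (xxs⊆ys (there p))
  ... | inj₁ q           = ∈-++⁺ˡ q
  ... | inj₂ (here refl) = contradiction refl (All.lookup x∉xs p)
  ... | inj₂ (there q)   = ∈-++⁺ʳ as q

d≤length : ∀ k (M : Matrix σ n) {ys} → blocks k M ⊆ ys → d k M ≤ length ys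
d≤length {σ} k M blocks⊆ys =
  Unique-length-≤ (deduplicate-! (blocks k M)) (blocks⊆ys ∘ ∈-deduplicate⁻ _≟ᴮ_ (blocks k M))
  where
  _≟ᴮ_ : DecidableEquality (List (List (Fin σ)))
  _≟ᴮ_ = ≡-dec (≡-dec _≟ᶠ_)
  open DecUnique _≟ᴮ_ using (deduplicate-!)

take-replicate : ∀ k {N} (x : A) → k ≤ N → take k (replicate N x) ≡ replicate k x
take-replicate zero    x _         = refl
take-replicate (suc k) x (s≤s k≤N) = cong (x L.∷_) (take-replicate k x k≤N)

drop-replicate : ∀ j N (x : A) → drop j (replicate N x) ≡ replicate (N ∸ j) x
drop-replicate zero    N       x = refl
drop-replicate (suc j) zero    x = refl
drop-replicate (suc j) (suc N) x = drop-replicate j N x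

window-replicate : ∀ k j {N} (x : A) → k + j ≤ N → window k j (replicate N x) ≡ replicate k x
window-replicate k j {N} x k+j≤N = begin
  take k (drop j (replicate N x))  ≡⟨ cong (take k) (drop-replicate j N x) ⟩
  take k (replicate (N ∸ j) x)     ≡⟨ take-replicate k x (m+n≤o⇒m≤o∸n k k+j≤N) ⟩
  replicate k x                    ∎
  where open ≡-Reasoning

length-window : ∀ k j (xs : List A) → k + j ≤ length xs → length (window k j xs) ≡ k
length-window k j xs k+j≤len = begin
  length (take k (drop j xs))   ≡⟨ length-take k (drop j xs) ⟩
  k ⊓ length (drop j xs)        ≡⟨ cong (k ⊓_) (length-drop j xs) ⟩
  k ⊓ (length xs ∸ j)           ≡⟨ m≤n⇒m⊓n≡m (m+n≤o⇒m≤o∸n k k+j≤len) ⟩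
  k                             ∎
  where open ≡-Reasoning

window-cons-replicate : ∀ k i {N} (x y : A) → suc k + i ≤ suc N →
  ∃[ h ] ((h ≡ x ⊎ h ≡ y) × window (suc k) i (x L.∷ replicate N y) ≡ h L.∷ replicate k y)
window-cons-replicate k zero    x y (s≤s k+0≤N) =
  x , inj₁ refl , cong (x L.∷_) (take-replicate k y (m+n≤o⇒m≤o k k+0≤N))
window-cons-replicate k (suc i) x y k+i<N =
  y , inj₂ refl , window-replicate (suc k) i y (≤-pred (≤-trans (≤-reflexive (sym (+-suc (suc k) i))) k+i<N))

corner-fits : ∀ {k j N} → k ≤ N → j < N ∸ k + 1 → k + j ≤ N
corner-fits {k} {j} {N} k≤N j<N∸k+1 = begin
  k + j         ≤⟨ +-monoʳ-≤ k (m<1+n⇒m≤n (subst (j <_) (+-comm (N ∸ k) 1) j<N∸k+1)) ⟩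
  k + (N ∸ k)   ≡⟨ m+[n∸m]≡n k≤N ⟩
  N             ∎
  where open ≤-Reasoning

topRow : Fin σ → Vec (Fin σ) (suc n) → Matrix σ (suc n)
topRow {n = n} z r = r ∷ V.replicate n (V.replicate (suc n) z)

rows-topRow : ∀ (z : Fin σ) (r : Vec (Fin σ) (suc n)) →
  map toList (toList (topRow z r)) ≡ toList r L.∷ replicate n (replicate (suc n) z)
rows-topRow {n = n} z r = cong (toList r L.∷_) (begin
  map toList (toList (V.replicate n (V.replicate (suc n) z)))  ≡⟨ cong (map toList) (toList-replicate n _) ⟩
  map toList (replicate n (V.replicate (suc n) z))             ≡⟨ map-replicate toList n _ ⟩
  replicate n (toList (V.replicate (suc n) z))                 ≡⟨ cong (replicate n) (toList-replicate (suc n) z) ⟩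
  replicate n (replicate (suc n) z)                            ∎)
  where open ≡-Reasoning

blocks-topRow : ∀ (z : Fin σ) (r : Vec (Fin σ) (suc n)) k {b} → suc k ≤ suc n →
  b ∈ blocks (suc k) (topRow z r) →
  ∃[ w ] ((w ≡ replicate (suc k) z ⊎ ∃[ j ] (suc k + j ≤ suc n × w ≡ window (suc k) j (toList r)))
         × b ≡ w L.∷ replicate k (replicate (suc k) z))
blocks-topRow {σ = σ} {n = n} z r k k≤n b∈
  with i , j , i∈ , j∈ , refl ← ∈-cartesianProductWith⁻ _ (upTo (suc n ∸ suc k + 1)) (upTo (suc n ∸ suc k + 1)) b∈
  with h , h≡r⊎z , rowsEq ← window-cons-replicate k i (toList r) (replicate (suc n) z) (corner-fits k≤n (∈-upTo⁻ i∈))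
  = window K j h , shape h≡r⊎z , blockEq
  where
  K : ℕ
  K = suc k
  zrow : List (Fin σ)
  zrow = replicate (suc n) z
  j-fits : K + j ≤ suc n
  j-fits = corner-fits k≤n (∈-upTo⁻ j∈)
  shape : (h ≡ toList r ⊎ h ≡ zrow) →
    window K j h ≡ replicate K z ⊎ ∃[ j' ] (K + j' ≤ suc n × window K j h ≡ window K j' (toList r))
  shape (inj₁ refl) = inj₂ (j , j-fits , refl)
  shape (inj₂ refl) = inj₁ (window-replicate K j z j-fits)
  blockEq : map (window K j) (window K i (map toList (toList (topRow z r)))) ≡ window K j h L.∷ replicate k (replicate K z)
  blockEq = begin
    map (window K j) (window K i (map toList (toList (topRow z r))))  ≡⟨ cong (λ rows → map (window K j) (window K i rows)) (rows-topRow z r) ⟩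
    map (window K j) (window K i (toList r L.∷ replicate n zrow))     ≡⟨ cong (map (window K j)) rowsEq ⟩
    window K j h L.∷ map (window K j) (replicate k zrow)              ≡⟨ cong (window K j h L.∷_) (map-replicate (window K j) k zrow) ⟩
    window K j h L.∷ replicate k (window K j zrow)                    ≡⟨ cong (λ w → window K j h L.∷ replicate k w) (window-replicate K j z j-fits) ⟩
    window K j h L.∷ replicate k (replicate K z)                      ∎
    where open ≡-Reasoning

d-topRow≤ : ∀ (z : Fin σ) (r : Vec (Fin σ) (suc n)) k (ws : List (List (Fin σ))) → 1 ≤ k → k ≤ suc n →
  replicate k z ∈ ws → (∀ j → k + j ≤ suc n → window k j (toList r) ∈ ws) → d k (topRow z r) ≤ length ws
d-topRow≤ {σ = σ} z r (suc k) ws _ k≤n blank∈ws windows∈ws = begin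
  d (suc k) (topRow z r)        ≤⟨ d≤length (suc k) (topRow z r) blocks⊆ ⟩
  length (map (L._∷ zeros) ws)  ≡⟨ length-map (L._∷ zeros) ws ⟩
  length ws                     ∎
  where
  open ≤-Reasoning
  zeros : List (List (Fin σ))
  zeros = replicate k (replicate (suc k) z)
  blocks⊆ : blocks (suc k) (topRow z r) ⊆ map (L._∷ zeros) ws
  blocks⊆ b∈ with blocks-topRow z r k k≤n b∈
  ... | w , inj₁ refl , refl = ∈-map⁺ (L._∷ zeros) blank∈ws
  ... | w , inj₂ (j , fits , refl) , refl = ∈-map⁺ (L._∷ zeros) (windows∈ws j fits)

d-topRow≤1+size : ∀ (z : Fin σ) (r : Vec (Fin σ) (suc n)) k → 1 ≤ k → k ≤ suc n → d k (topRow z r) ≤ suc (suc n)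
d-topRow≤1+size {σ = σ} {n = n} z r (suc k) 1≤k k≤n = begin
  d (suc k) (topRow z r)   ≤⟨ d-topRow≤ z r (suc k) ws 1≤k k≤n (here refl) window∈ws ⟩
  length ws                ≡⟨ cong suc (trans (length-map _ (upTo corners)) (length-upTo corners)) ⟩
  suc (n ∸ k + 1)          ≡⟨ cong suc (+-comm (n ∸ k) 1) ⟩
  suc (suc (n ∸ k))        ≤⟨ s≤s (s≤s (m∸n≤m n k)) ⟩
  suc (suc n)              ∎
  where
  open ≤-Reasoning
  corners : ℕ
  corners = suc n ∸ suc k + 1
  ws : List (List (Fin σ))
  ws = replicate (suc k) z L.∷ map (λ j → window (suc k) j (toList r)) (upTo corners)
  window∈ws : ∀ j → suc k + j ≤ suc n → window (suc k) j (toList r) ∈ ws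
  window∈ws j fits = there (∈-map⁺ _ (∈-upTo⁺ (subst (j <_) (+-comm 1 (n ∸ k))
                       (s≤s (m+n≤o⇒m≤o∸n j (subst (_≤ suc n) (+-comm (suc k) j) fits))))))

off on : Fin 2
off = zero
on  = suc zero

-- Sparse g c xs: consecutive 1s of xs are separated by at least g 0s, and at least c 0s
-- precede its first 1.
data Sparse (g : ℕ) : ℕ → List (Fin 2) → Set where
  []   : ∀ {c} → Sparse g c L.[]
  off∷ : ∀ {c xs} → Sparse g (pred c) xs → Sparse g c (off L.∷ xs)
  on∷  : ∀ {xs} → Sparse g g xs → Sparse g 0 (on L.∷ xs)

Sparse-weaken : ∀ {g c c' xs} → c' ≤ c → Sparse g c xs → Sparse g c' xs
Sparse-weaken c'≤c []       = []
Sparse-weaken c'≤c (off∷ s) = off∷ (Sparse-weaken (pred-mono-≤ c'≤c) s)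
Sparse-weaken z≤n  (on∷ s)  = on∷ s

Sparse-drop : ∀ {g xs} j → Sparse g 0 xs → Sparse g 0 (drop j xs)
Sparse-drop zero    s        = s
Sparse-drop (suc j) []       = []
Sparse-drop (suc j) (off∷ s) = Sparse-drop j s
Sparse-drop (suc j) (on∷ s)  = Sparse-drop j (Sparse-weaken z≤n s)

Sparse-take : ∀ {g c xs} k → Sparse g c xs → Sparse g c (take k xs)
Sparse-take zero    s        = []
Sparse-take (suc k) []       = []
Sparse-take (suc k) (off∷ s) = off∷ (Sparse-take k s)
Sparse-take (suc k) (on∷ s)  = on∷ (Sparse-take k s)

Sparse-window : ∀ {g xs} k j → Sparse g 0 xs → Sparse g 0 (window k j xs)
Sparse-window k j = Sparse-take k ∘ Sparse-drop j

Sparse-replicate-++ : ∀ {g} c b {xs} → Sparse g (c ∸ b) xs → Sparse g c (replicate b off ++ xs)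
Sparse-replicate-++ c       zero    s = s
Sparse-replicate-++ {g} zero (suc b) {xs} s =
  off∷ (Sparse-replicate-++ zero b (subst (λ c → Sparse g c xs) (sym (0∸n≡0 b)) s))
Sparse-replicate-++ (suc c) (suc b) s = off∷ (Sparse-replicate-++ c b s)

Sparse-short⇒blank : ∀ {g c xs} → Sparse g c xs → length xs ≤ c → xs ≡ replicate (length xs) off
Sparse-short⇒blank []       _            = refl
Sparse-short⇒blank (off∷ s) (s≤s len≤c) = cong (off L.∷_) (Sparse-short⇒blank s len≤c)

-- oneHot k a is the 0/1 word of length k whose only 1 is at position a; it is blank if a ≥ k.
oneHot : ℕ → ℕ → List (Fin 2)
oneHot zero    a       = L.[]
oneHot (suc k) zero    = on L.∷ replicate k off
oneHot (suc k) (suc a) = off L.∷ oneHot k a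

oneHot-blank : ∀ k → oneHot k k ≡ replicate k off
oneHot-blank zero    = refl
oneHot-blank (suc k) = cong (off L.∷_) (oneHot-blank k)

Sparse-short⇒oneHot : ∀ {g xs} → Sparse g 0 xs → length xs ≤ suc g → ∃[ a ] (a ≤ length xs × xs ≡ oneHot (length xs) a)
Sparse-short⇒oneHot [] _ = 0 , z≤n , refl
Sparse-short⇒oneHot (off∷ s) len≤ with a , a≤ , eq ← Sparse-short⇒oneHot s (≤-trans (n≤1+n _) len≤) =
  suc a , s≤s a≤ , cong (off L.∷_) eq
Sparse-short⇒oneHot (on∷ s) (s≤s len≤g) = 0 , z≤n , cong (on L.∷_) (Sparse-short⇒blank s len≤g)

oneHot∈ : ∀ {a} k → a ≤ k → oneHot k a ∈ map (oneHot k) (upTo (suc k))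
oneHot∈ k a≤k = ∈-map⁺ (oneHot k) (∈-upTo⁺ (s≤s a≤k))

Sparse-short∈oneHots : ∀ {g k xs} → Sparse g 0 xs → length xs ≡ k → k ≤ suc g → xs ∈ map (oneHot k) (upTo (suc k))
Sparse-short∈oneHots s refl len≤g with a , a≤ , xs≡ ← Sparse-short⇒oneHot s len≤g =
  subst (_∈ _) (sym xs≡) (oneHot∈ _ a≤)

d-topRow-Sparse≤ : ∀ {g} (r : Vec (Fin 2) (suc n)) k → Sparse g 0 (toList r) →
  1 ≤ k → k ≤ suc g → k ≤ suc n → d k (topRow off r) ≤ suc k
d-topRow-Sparse≤ {n = n} r k sparse 1≤k k≤g k≤n = begin
  d k (topRow off r)                       ≤⟨ d-topRow≤ off r k ws 1≤k k≤n blank∈ws window∈ws ⟩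
  length ws                                ≡⟨ trans (length-map (oneHot k) (upTo (suc k))) (length-upTo (suc k)) ⟩
  suc k                                    ∎
  where
  open ≤-Reasoning
  ws : List (List (Fin 2))
  ws = map (oneHot k) (upTo (suc k))
  blank∈ws : replicate k off ∈ ws
  blank∈ws = subst (_∈ ws) (oneHot-blank k) (oneHot∈ k ≤-refl)
  window∈ws : ∀ j → k + j ≤ suc n → window k j (toList r) ∈ ws
  window∈ws j fits = Sparse-short∈oneHots (Sparse-window k j sparse)
    (length-window k j (toList r) (subst (k + j ≤_) (sym (length-toList r)) fits)) k≤g

1+n≤2*n*n : ∀ k → 1 ≤ k → suc k ≤ 2 * (k * k)
1+n≤2*n*n k@(suc _) 1≤k = begin
  1 + k             ≤⟨ +-mono-≤ (*-mono-≤ 1≤k 1≤k) (m≤m*n k k) ⟩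
  k * k + k * k     ≡⟨ cong (k * k +_) (+-identityʳ (k * k)) ⟨
  2 * (k * k)       ∎
  where open ≤-Reasoning

δ2D≤-topRow-Sparse : ∀ {g} (r : Vec (Fin 2) (suc n)) → Sparse g 0 (toList r) →
  2 + n ≤ 2 * (suc g * suc g) → δ2D≤ (topRow off r) 2
δ2D≤-topRow-Sparse {n = n} {g = g} r sparse size≤ k 1≤k k≤n with k ≤? suc g
... | yes k≤g = ≤-trans (d-topRow-Sparse≤ r k sparse 1≤k k≤g k≤n) (1+n≤2*n*n k 1≤k)
... | no  k≰g = begin
  d k (topRow off r)      ≤⟨ d-topRow≤1+size off r k 1≤k k≤n ⟩
  2 + n                   ≤⟨ size≤ ⟩
  2 * (suc g * suc g)     ≤⟨ *-monoʳ-≤ 2 (*-mono-≤ g<k g<k) ⟩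
  2 * (k * k)             ∎
  where
  open ≤-Reasoning
  g<k : suc g ≤ k
  g<k = <⇒≤ (≰⇒> k≰g)

encodeSymbol : ∀ {L} e → Fin L → Vec (Fin 2) (L + e)
encodeSymbol {suc L} e zero    = on ∷ V.replicate (L + e) off
encodeSymbol {suc L} e (suc i) = off ∷ encodeSymbol e i

encode : ∀ {m t} e → Vec (Fin m) t → Vec (Fin 2) (t * (m + e))
encode e []       = []
encode e (x ∷ xs) = encodeSymbol e x V.++ encode e xs

encodeSymbol-injective : ∀ {L} e {i j : Fin L} → encodeSymbol e i ≡ encodeSymbol e j → i ≡ j
encodeSymbol-injective {suc L} e {zero}  {zero}  eq = refl
encodeSymbol-injective {suc L} e {suc i} {suc j} eq = cong suc (encodeSymbol-injective e (∷-injectiveʳ eq))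

encode-injective : ∀ {m t} e {xs ys : Vec (Fin m) t} → encode e xs ≡ encode e ys → xs ≡ ys
encode-injective e {[]}     {[]}     eq = refl
encode-injective e {x ∷ xs} {y ∷ ys} eq with x≡y , xs≡ys ← ++-injective (encodeSymbol e x) (encodeSymbol e y) eq =
  cong₂ _∷_ (encodeSymbol-injective e x≡y) (encode-injective e xs≡ys)

Sparse-encodeSymbol-++ : ∀ {g L} e (i : Fin L) {xs} → g ≤ e → Sparse g 0 xs → Sparse g 0 (toList (encodeSymbol e i) ++ xs)
Sparse-encodeSymbol-++ {g} {suc L} e zero {xs} g≤e s rewrite toList-replicate (L + e) off =
  on∷ (Sparse-replicate-++ g (L + e) (subst (λ c → Sparse g c xs) (sym (m≤n⇒m∸n≡0 (≤-trans g≤e (m≤n+m e L)))) s))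
Sparse-encodeSymbol-++ {L = suc L} e (suc i) g≤e s = off∷ (Sparse-encodeSymbol-++ e i g≤e s)

Sparse-encode : ∀ {g m t} e (xs : Vec (Fin m) t) → g ≤ e → Sparse g 0 (toList (encode e xs))
Sparse-encode e []       g≤e = []
Sparse-encode e (x ∷ xs) g≤e rewrite toList-++ (encodeSymbol e x) (encode e xs) =
  Sparse-encodeSymbol-++ e x g≤e (Sparse-encode e xs g≤e)

allVecs : ∀ m t → List (Vec (Fin m) t)
allVecs m zero    = [] L.∷ L.[]
allVecs m (suc t) = cartesianProductWith _∷_ (allFin m) (allVecs m t)

length-cartesianProductWith : ∀ {B C : Set} (f : A → B → C) xs ys →
  length (cartesianProductWith f xs ys) ≡ length xs * length ys
length-cartesianProductWith f L.[]        ys = refl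
length-cartesianProductWith f (x L.∷ xs) ys = trans (length-++ (map (f x) ys))
  (cong₂ _+_ (length-map (f x) ys) (length-cartesianProductWith f xs ys))

length-allVecs : ∀ m t → length (allVecs m t) ≡ m ^ t
length-allVecs m zero    = refl
length-allVecs m (suc t) = trans (length-cartesianProductWith _∷_ (allFin m) (allVecs m t))
  (cong₂ _*_ (length-tabulate {n = m} (λ i → i)) (length-allVecs m t))

allVecs-Unique : ∀ m t → Unique (allVecs m t)
allVecs-Unique m zero    = All.[] ∷ []
allVecs-Unique m (suc t) = cartesianProductWith⁺ _∷_ ∷-injective (allFin⁺ m) (allVecs-Unique m t)

codeSize : ℕ → ℕ
codeSize m = suc m * (suc m + suc m)

codeMatrix : ∀ {m} → Vec (Fin (suc m)) (suc m) → Matrix 2 (codeSize m)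
codeMatrix {m} xs = topRow off (encode (suc m) xs)

codeMatrices : ∀ m → List (Matrix 2 (codeSize m))
codeMatrices m = map codeMatrix (allVecs (suc m) (suc m))

codeMatrices-Unique : ∀ m → Unique (codeMatrices m)
codeMatrices-Unique m = map⁺ (encode-injective (suc m) ∘ ∷-injectiveˡ) (allVecs-Unique (suc m) (suc m))

1+n*[n+n]≤2*[1+n]*[1+n] : ∀ m → suc (m * (m + m)) ≤ 2 * (suc m * suc m)
1+n*[n+n]≤2*[1+n]*[1+n] m = begin
  suc (m * (m + m))                          ≤⟨ m≤m+n _ (suc (4 * m)) ⟩
  suc (m * (m + m)) + suc (4 * m)            ≡⟨ solve 1 (λ m → (con 1 :+ m :* (m :+ m)) :+ (con 1 :+ con 4 :* m)
                                                   := con 2 :* ((con 1 :+ m) :* (con 1 :+ m))) refl m ⟩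
  2 * (suc m * suc m)                        ∎
  where
  open ≤-Reasoning
  open +-*-Solver

codeMatrices-δ2D≤ : ∀ m → All (λ M → δ2D≤ M 2) (codeMatrices m)
codeMatrices-δ2D≤ m = All.map⁺ (All.universal δ2D≤-codeMatrix (allVecs (suc m) (suc m)))
  where
  δ2D≤-codeMatrix : (xs : Vec (Fin (suc m)) (suc m)) → δ2D≤ (codeMatrix xs) 2
  δ2D≤-codeMatrix xs = δ2D≤-topRow-Sparse (encode (suc m) xs) (Sparse-encode (suc m) xs ≤-refl)
                         (1+n*[n+n]≤2*[1+n]*[1+n] (suc m))

length-codeMatrices : ∀ m → length (codeMatrices m) ≡ suc m ^ suc m
length-codeMatrices m = trans (length-map codeMatrix (allVecs (suc m) (suc m))) (length-allVecs (suc m) (suc m))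

n<2^n : ∀ n → n < 2 ^ n
n<2^n zero    = s≤s z≤n
n<2^n (suc n) = begin-strict
  suc n          <⟨ s≤s (n<2^n n) ⟩
  suc (2 ^ n)    ≤⟨ +-monoˡ-≤ (2 ^ n) (m^n>0 2 n) ⟩
  2 ^ n + 2 ^ n  ≡⟨ cong (2 ^ n +_) (+-identityʳ (2 ^ n)) ⟨
  2 ^ suc n      ∎
  where open ≤-Reasoning

2*P²*[1+2E]²≤[5*E*P]² : ∀ E P → 1 ≤ E → 2 * (P * P) * suc (E + E) ^ 2 ≤ (5 * (E * P)) ^ 2
2*P²*[1+2E]²≤[5*E*P]² E P 1≤E = begin
  2 * (P * P) * suc (E + E) ^ 2                  ≤⟨ *-monoʳ-≤ (2 * (P * P)) (^-monoˡ-≤ 2 (+-monoˡ-≤ (E + E) 1≤E)) ⟩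
  2 * (P * P) * (E + (E + E)) ^ 2                ≡⟨ solve 2 (λ E P → con 2 :* (P :* P) :* ((E :+ (E :+ E)) :^ 2)
                                                      := con 18 :* ((E :* P) :^ 2)) refl E P ⟩
  18 * (E * P) ^ 2                               ≤⟨ *-monoˡ-≤ ((E * P) ^ 2) (m≤m+n 18 7) ⟩
  25 * (E * P) ^ 2                               ≡⟨ solve 2 (λ E P → con 25 :* ((E :* P) :^ 2) := (con 5 :* (E :* P)) :^ 2) refl E P ⟩
  (5 * (E * P)) ^ 2                              ∎
  where
  open ≤-Reasoning
  open +-*-Solver

entropy-bound : ∀ e P → P ≡ 2 ^ suc e → P * (P + P) * ⌊log₂ (P * (P + P)) ⌋ ^ 2 ≤ (5 * ⌈log₂ (P ^ P) ⌉) ^ 2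
entropy-bound e P refl = begin
  P * (P + P) * ⌊log₂ (P * (P + P)) ⌋ ^ 2     ≡⟨ cong (λ n → n * ⌊log₂ n ⌋ ^ 2) n≡2*P*P ⟩
  2 * (P * P) * ⌊log₂ (2 * (P * P)) ⌋ ^ 2     ≡⟨ cong (λ l → 2 * (P * P) * l ^ 2) log₂n ⟩
  2 * (P * P) * suc (E + E) ^ 2              ≤⟨ 2*P²*[1+2E]²≤[5*E*P]² E P (s≤s z≤n) ⟩
  (5 * (E * P)) ^ 2                          ≡⟨ cong (λ l → (5 * l) ^ 2) log₂P^P ⟨
  (5 * ⌈log₂ (P ^ P) ⌉) ^ 2                  ∎
  where
  open ≤-Reasoning
  E : ℕ
  E = suc e
  n≡2*P*P : P * (P + P) ≡ 2 * (P * P)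
  n≡2*P*P = trans (*-distribˡ-+ P P P) (cong (P * P +_) (sym (+-identityʳ (P * P))))
  log₂n : ⌊log₂ (2 * (P * P)) ⌋ ≡ suc (E + E)
  log₂n = trans (cong (λ x → ⌊log₂ (2 * x) ⌋) (sym (^-distribˡ-+-* 2 E E))) (⌊log₂[2^n]⌋≡n (suc (E + E)))
  log₂P^P : ⌈log₂ (P ^ P) ⌉ ≡ E * P
  log₂P^P = trans (cong ⌈log₂_⌉ (^-*-assoc 2 E P)) (⌈log₂2^n⌉≡n (E * P))

lemma5 : ∃[ σ ] ∃[ c ] ∃[ q ] ((N : ℕ) → ∃[ n ] (n ≥ N × Σ (List (Matrix σ n)) (λ F → Unique F × All (λ M → δ2D≤ M c) F × n * ⌊log₂ n ⌋ ^ 2 ≤ (q * ⌈log₂ length F ⌉) ^ 2)))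
lemma5 = 2 , 2 , 5 , λ N → codeSize (m N) , N≤codeSize N , codeMatrices (m N) , codeMatrices-Unique (m N) , codeMatrices-δ2D≤ (m N) ,
  subst (λ L → codeSize (m N) * ⌊log₂ codeSize (m N) ⌋ ^ 2 ≤ (5 * ⌈log₂ L ⌉) ^ 2) (sym (length-codeMatrices (m N)))
        (entropy-bound N (suc (m N)) (1+m≡2^[1+N] N))
  where
  m : ℕ → ℕ
  m N = pred (2 ^ suc N)
  1+m≡2^[1+N] : ∀ N → suc (m N) ≡ 2 ^ suc N
  1+m≡2^[1+N] N = suc-pred (2 ^ suc N) {{m^n≢0 2 (suc N)}}
  N≤codeSize : ∀ N → N ≤ codeSize (m N)
  N≤codeSize N = begin
    N                 ≤⟨ n≤1+n N ⟩
    suc N             ≤⟨ <⇒≤ (n<2^n (suc N)) ⟩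
    2 ^ suc N         ≡⟨ 1+m≡2^[1+N] N ⟨
    suc (m N)         ≤⟨ m≤m*n (suc (m N)) (suc (m N) + suc (m N)) ⟩
    codeSize (m N)    ∎
    where open ≤-Reasoning
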